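{- Let $G=(V,E)$ be a graph and let $I\subseteq V$ be an independent set such that $|I|\ge s(G)-1$ and such that $V_0\cap I=\emptyset$ for some unipolar representation $(V_0,V_1)$ of $G$. Construct a partition of $V$ as follows: set $U:=V$; processing the vertices $i\in I$ one at a time in any order, form the block $N^+(i)\cap U$ and then set $U:=U\setminus N^+(i)$; finally, form one more block consisting of the remaining set $U$ (if nonempty). Then the resulting partition of $V$ is a block decomposition of $G$ with respect to some unipolar representation of $G$.
   Context: $N^+(v)=N(v)\cup\{v\}$ denotes the closed neighbourhood of $v$. A unipolar representation of a graph $G=(V,E)$ is an ordered pair $(V_0,V_1)$ with $V_0\cap V_1=\emptyset$, $V_0\cup V_1=V$, $V_0$ a clique (the central clique), and $G[V_1]$ a disjoint union of cliques; the side cliques of the representation are the maximal cliques of $G[V_1]$. A graph is unipolar if it has a unipolar representation. For a unipolar graph $G$, $s(G)$ is the maximum, over all unipolar representations $R$ of $G$, of the number of side cliques of $R$; for a non-unipolar graph $s(G)=0$. A partition $\mathcal{B}$ of $V$ is a block decomposition of $G$ with respect to a representation $R=(V_0,V_1)$ if the intersection of each part of $\mathcal{B}$ with $V_1$ is either a side clique of $R$ or empty. -}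

module Defs where

open import Data.Nat using (ℕ; zero; suc; _∸_; _≤_)
open import Data.Fin using (Fin; _≟_)
open import Data.Bool using (Bool; true; false; T; _∧_; _∨_; not; if_then_else_)
open import Data.List using (List; []; _∷_; length; allFin)
open import Data.Bool.ListAction using (any)
open import Data.List.Membership.Propositional using (_∈_)
open import Data.Product using (Σ; ∃; _×_; _,_)
open import Data.Sum using (_⊎_)
open import Function.Bundles using (_⇔_)
open import Relation.Nullary using (¬_)
open import Relation.Nullary.Decidable using (⌊_⌋)
open import Relation.Binary.PropositionalEquality using (_≡_; _≢_)

record Graph (n : ℕ) : Set where
  field
    adj    : Fin n → Fin n → Bool
    sym    : ∀ u v → adj u v ≡ adj v u
    irrefl : ∀ v → adj v v ≡ false
open Graph public

VSet : ℕ → Set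
VSet n = Fin n → Bool

_≐_ : ∀ {n} → VSet n → VSet n → Set
S ≐ S' = ∀ v → S v ≡ S' v

IsClique : ∀ {n} → Graph n → VSet n → Set
IsClique G S = ∀ u v → T (S u) → T (S v) → u ≢ v → T (adj G u v)

-- G[W] is a disjoint union of cliques: there is a labelling of the vertices
-- (label = which clique) such that two distinct vertices of W are adjacent
-- iff they carry the same label.
IsDisjointUnionOfCliques : ∀ {n} → Graph n → VSet n → Set
IsDisjointUnionOfCliques {n} G W =
  Σ (Fin n → ℕ) λ c → ∀ u v → T (W u) → T (W v) → u ≢ v →
    (T (adj G u v) ⇔ (c u ≡ c v))

-- A unipolar representation (V0 , V1).  Since V0 and V1 must be disjoint
-- with union V, the pair is determined by V1, and V0 is its complement.
record UnipolarRep {n : ℕ} (G : Graph n) : Set where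
  field
    V1      : VSet n
    central : IsClique G (λ v → not (V1 v))
    sides   : IsDisjointUnionOfCliques G V1
open UnipolarRep public

V0 : ∀ {n} {G : Graph n} → UnipolarRep G → VSet n
V0 R v = not (V1 R v)

IsSideClique : ∀ {n} {G : Graph n} → UnipolarRep G → VSet n → Set
IsSideClique {n} {G} R S =
  (∀ v → T (S v) → T (V1 R v)) ×
  IsClique G S ×
  (∀ v → T (V1 R v) → ¬ T (S v) → ¬ (∀ u → T (S u) → T (adj G v u)))

-- R has exactly k side cliques: the side cliques (up to extensional
-- equality) are in bijection with Fin k.
NumSides : ∀ {n} {G : Graph n} → UnipolarRep G → ℕ → Set
NumSides {n} R k =
  Σ (Fin k → VSet n) λ f →
    (∀ j → IsSideClique R (f j)) ×
    (∀ j j' → f j ≐ f j' → j ≡ j') ×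
    (∀ S → IsSideClique R S → ∃ λ j → S ≐ f j)

IsS : ∀ {n} → Graph n → ℕ → Set
IsS G k =
  (Σ (UnipolarRep G) λ R → NumSides R k) ×
  (∀ (R : UnipolarRep G) k' → NumSides R k' → k' ≤ k)

N⁺ : ∀ {n} → Graph n → Fin n → VSet n
N⁺ G i v = adj G i v ∨ ⌊ i ≟ v ⌋

Independent : ∀ {n} → Graph n → List (Fin n) → Set
Independent G I = ∀ u v → u ∈ I → v ∈ I → ¬ T (adj G u v)

nonempty? : ∀ {n} → VSet n → Bool
nonempty? {n} U = any U (allFin n)

blocksFrom : ∀ {n} → Graph n → VSet n → List (Fin n) → List (VSet n)
blocksFrom G U [] = if nonempty? U then U ∷ [] else []
blocksFrom G U (i ∷ is) =
  (λ v → N⁺ G i v ∧ U v) ∷ blocksFrom G (λ v → U v ∧ not (N⁺ G i v)) is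

blocks : ∀ {n} → Graph n → List (Fin n) → List (VSet n)
blocks G is = blocksFrom G (λ _ → true) is

countContaining : ∀ {n} → Fin n → List (VSet n) → ℕ
countContaining v [] = 0
countContaining v (B ∷ Bs) =
  if B v then suc (countContaining v Bs) else countContaining v Bs

IsPartition : ∀ {n} → List (VSet n) → Set
IsPartition Bs =
  (∀ B → B ∈ Bs → ∃ λ v → T (B v)) × (∀ v → countContaining v Bs ≡ 1)

IsBlockDecomposition : ∀ {n} {G : Graph n} → UnipolarRep G → List (VSet n) → Set
IsBlockDecomposition R Bs =
  IsPartition Bs ×
  (∀ B → B ∈ Bs →
     (∀ v → T (B v) → ¬ T (V1 R v)) ⊎ IsSideClique R (λ v → B v ∧ V1 R v))

-- Fix a unipolar representation R with I ⊆ V1.  For i ∈ V1 the set N⁺(i) ∩ V1 is the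
-- side clique of i, and the vertices of the independent set I lie in pairwise distinct
-- side cliques.  Hence the block built for i meets V1 exactly in the side clique of i,
-- and the final block meets V1 in the union of the side cliques containing no vertex
-- of I.  As R has at most s(G) ≤ |I| + 1 side cliques, at most one side clique avoids
-- I, so the final block meets V1 in a side clique or not at all.  That the blocks
-- partition V needs only independence: no i ∈ I lies in an earlier N⁺(j).

module Submission where

open import Defs
open import Data.Nat using (ℕ; suc; _∸_; _≤_; z≤n; s≤s) renaming (_≟_ to _≟ℕ_)
open import Data.Nat.Properties using (≤-trans; ∸-monoˡ-≤; n≮n)
open import Data.Fin as Fin using (Fin; _≟_)
open import Data.Fin.Properties using (any?)
open import Data.Bool using (true; false; T; _∧_; not; if_then_else_)
open import Data.Bool.Properties using (T-∧; T-∨)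
open import Data.List using (List; []; _∷_; _++_; length; map; filter; lookup; allFin; deduplicate)
open import Data.List.Properties using (length-map; length-++-sucʳ)
open import Data.List.Relation.Unary.All as All using (All; []; _∷_)
open import Data.List.Relation.Unary.All.Properties using (All¬⇒¬Any) renaming (map⁺ to All-map⁺)
open import Data.List.Relation.Unary.AllPairs using ([]; _∷_)
open import Data.List.Relation.Unary.Any using (here; there; index; satisfied; toSum)
open import Data.List.Relation.Unary.Any.Properties using (any⁺; any⁻; lookup-index)
open import Data.List.Relation.Unary.Unique.Propositional using (Unique)
open import Data.List.Relation.Unary.Unique.DecPropositional.Properties _≟ℕ_ using (deduplicate-!)
open import Data.List.Membership.Propositional using (_∈_; _∉_; lose)
open import Data.List.Membership.Propositional.Properties
  using (∈-allFin; ∈-lookup; ∈-map⁺; ∈-map⁻; ∈-filter⁺; ∈-filter⁻;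
         ∈-deduplicate⁺; ∈-deduplicate⁻; ∈-∃++; ∈-++⁻; ∈-++⁺ˡ; ∈-++⁺ʳ)
open import Data.Product using (Σ; ∃; _×_; _,_; proj₁; proj₂)
open import Data.Sum using (_⊎_; inj₁; inj₂; [_,_]; map₂)
open import Data.Empty using (⊥-elim)
open import Function using (_∘_; id)
open import Function.Bundles using (_⇔_; mk⇔; Equivalence)
open import Relation.Nullary using (¬_; yes; no; contradiction)
open import Relation.Nullary.Decidable using (⌊_⌋; T?; toWitness; fromWitness)
open import Relation.Binary.PropositionalEquality using (_≡_; _≢_; refl; trans; cong; subst)
import Relation.Binary.PropositionalEquality as ≡

open Equivalence using (to; from)

T-injective : ∀ {x y} → (T x ⇔ T y) → x ≡ y
T-injective {true}  {true}  _   = refl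
T-injective {true}  {false} x⇔y = ⊥-elim (to x⇔y _)
T-injective {false} {true}  x⇔y = ⊥-elim (from x⇔y _)
T-injective {false} {false} _   = refl

T-not : ∀ {x} → T (not x) ⇔ (¬ T x)
T-not {true}  = mk⇔ (λ ()) (λ ¬⊤ → ¬⊤ _)
T-not {false} = mk⇔ (λ _ ()) (λ _ → _)

Unique⇒lookup-injective : ∀ {a} {A : Set a} {xs : List A} → Unique xs →
                          ∀ i j → lookup xs i ≡ lookup xs j → i ≡ j
Unique⇒lookup-injective (_ ∷ _)     Fin.zero    Fin.zero    _  = refl
Unique⇒lookup-injective (x∉xs ∷ _)  Fin.zero    (Fin.suc j) eq =
  contradiction eq (All.lookup x∉xs (∈-lookup j))
Unique⇒lookup-injective (x∉xs ∷ _)  (Fin.suc i) Fin.zero    eq =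
  contradiction (≡.sym eq) (All.lookup x∉xs (∈-lookup i))
Unique⇒lookup-injective (_ ∷ !xs)   (Fin.suc i) (Fin.suc j) eq =
  cong Fin.suc (Unique⇒lookup-injective !xs i j eq)

Unique∧⊆⇒length≤ : ∀ {a} {A : Set a} {xs ys : List A} → Unique xs →
                   (∀ {x} → x ∈ xs → x ∈ ys) → length xs ≤ length ys
Unique∧⊆⇒length≤ {xs = []}     _             _     = z≤n
Unique∧⊆⇒length≤ {xs = x ∷ xs} (x∉xs ∷ !xs) xs⊆ys with ∈-∃++ (xs⊆ys (here refl))
... | ys₁ , ys₂ , refl =
  subst (suc (length xs) ≤_) (≡.sym (length-++-sucʳ ys₁ x ys₂)) (s≤s (Unique∧⊆⇒length≤ !xs xs⊆ys₁ys₂))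
  where
  xs⊆ys₁ys₂ : ∀ {y} → y ∈ xs → y ∈ ys₁ ++ ys₂
  xs⊆ys₁ys₂ y∈xs with ∈-++⁻ ys₁ (xs⊆ys (there y∈xs))
  ... | inj₁ y∈ys₁           = ∈-++⁺ˡ y∈ys₁
  ... | inj₂ (here refl)     = contradiction refl (All.lookup x∉xs y∈xs)
  ... | inj₂ (there y∈ys₂)   = ∈-++⁺ʳ ys₁ y∈ys₂

Unique-map-injectiveOn : ∀ {a b} {A : Set a} {B : Set b} {f : A → B} {xs : List A} →
              (∀ {x y} → x ∈ xs → y ∈ xs → f x ≡ f y → x ≡ y) →
              Unique xs → Unique (map f xs)
Unique-map-injectiveOn _   []            = []
Unique-map-injectiveOn inj (x∉xs ∷ !xs) =
  All-map⁺ (All.tabulate λ y∈xs fx≡fy → All.lookup x∉xs y∈xs (inj (here refl) (there y∈xs) fx≡fy))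
  ∷ Unique-map-injectiveOn (λ x∈ y∈ → inj (there x∈) (there y∈)) !xs

nonempty?-complete : ∀ {n} (U : VSet n) {v} → T (U v) → T (nonempty? U)
nonempty?-complete U {v} v∈U = any⁺ U (lose (∈-allFin v) v∈U)

nonempty?-sound : ∀ {n} (U : VSet n) → T (nonempty? U) → ∃ λ v → T (U v)
nonempty?-sound {n} U ne = satisfied (any⁻ U (allFin n) ne)

module _ {n} (G : Graph n) where

  adjacent⇒≢ : ∀ {u v} → T (adj G u v) → u ≢ v
  adjacent⇒≢ {u} u∼u refl = subst T (irrefl G u) u∼u

  T-N⁺ : ∀ {i v} → T (N⁺ G i v) ⇔ (T (adj G i v) ⊎ i ≡ v)
  T-N⁺ = mk⇔ (map₂ toWitness ∘ to T-∨) (from T-∨ ∘ map₂ fromWitness)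

  countContaining-blocksFrom : ∀ U is v → countContaining v (blocksFrom G U is) ≡ (if U v then 1 else 0)
  countContaining-blocksFrom U [] v with nonempty? U in ne
  ... | true = refl
  ... | false with U v in v∈U
  ...   | false = refl
  ...   | true  = contradiction (subst T ne (nonempty?-complete U (subst T (≡.sym v∈U) _))) λ ()
  countContaining-blocksFrom U (i ∷ is) v
    rewrite countContaining-blocksFrom (λ w → U w ∧ not (N⁺ G i w)) is v
    with N⁺ G i v | U v
  ... | true  | true  = refl
  ... | true  | false = refl
  ... | false | true  = refl
  ... | false | false = refl

  blocksFrom-nonempty : ∀ {U is} → All (T ∘ U) is → Unique is → Independent G is →
                        ∀ {B} → B ∈ blocksFrom G U is → ∃ λ v → T (B v)
  blocksFrom-nonempty {U} {[]} _ _ _ _ with nonempty? U in ne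
  blocksFrom-nonempty {U} {[]} _ _ _ (here refl) | true = nonempty?-sound U (subst T (≡.sym ne) _)
  blocksFrom-nonempty {U} {i ∷ is} (i∈U ∷ _) _ _ (here refl) = i , from T-∧ (from T-N⁺ (inj₂ refl) , i∈U)
  blocksFrom-nonempty {U} {i ∷ is} (_ ∷ is⊆U) (i∉is ∷ !is) indep (there B∈) =
    blocksFrom-nonempty (All.tabulate survives) !is (λ u v u∈ v∈ → indep u v (there u∈) (there v∈)) B∈
    where
    survives : ∀ {j} → j ∈ is → T (U j ∧ not (N⁺ G i j))
    survives j∈is = from T-∧ (All.lookup is⊆U j∈is , from T-not
      ([ indep i _ (here refl) (there j∈is) , All.lookup i∉is j∈is ] ∘ to T-N⁺))

  blocks-isPartition : ∀ {I} → Unique I → Independent G I → IsPartition (blocks G I)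
  blocks-isPartition {I} !I indep =
    (λ _ → blocksFrom-nonempty (All.tabulate λ _ → _) !I indep) ,
    countContaining-blocksFrom (λ _ → true) I

module Labelling {n} {G : Graph n} (R : UnipolarRep G) where

  label : Fin n → ℕ
  label = proj₁ (sides R)

  adjacent⇔sameLabel : ∀ {u v} → T (V1 R u) → T (V1 R v) → u ≢ v → T (adj G u v) ⇔ (label u ≡ label v)
  adjacent⇔sameLabel = proj₂ (sides R) _ _

  adjacent⇒sameLabel : ∀ {u v} → T (V1 R u) → T (V1 R v) → T (adj G u v) → label u ≡ label v
  adjacent⇒sameLabel u∈V1 v∈V1 u∼v = to (adjacent⇔sameLabel u∈V1 v∈V1 (adjacent⇒≢ G u∼v)) u∼v

  N⁺⇔sameLabel : ∀ {i v} → T (V1 R i) → T (V1 R v) → T (N⁺ G i v) ⇔ (label i ≡ label v)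
  N⁺⇔sameLabel {i} {v} i∈V1 v∈V1 =
    mk⇔ ([ adjacent⇒sameLabel i∈V1 v∈V1 , cong label ] ∘ to (T-N⁺ G)) (from (T-N⁺ G) ∘ adjacentOrEqual)
    where
    adjacentOrEqual : label i ≡ label v → T (adj G i v) ⊎ i ≡ v
    adjacentOrEqual ℓ≡ with i ≟ v
    ... | yes i≡v = inj₂ i≡v
    ... | no i≢v  = inj₁ (from (adjacent⇔sameLabel i∈V1 v∈V1 i≢v) ℓ≡)

  IsLabelClass : ℕ → VSet n → Set
  IsLabelClass ℓ S = ∀ v → T (S v) ⇔ (T (V1 R v) × label v ≡ ℓ)

  labelClass : ℕ → VSet n
  labelClass ℓ v = V1 R v ∧ ⌊ label v ≟ℕ ℓ ⌋

  labelClass-isLabelClass : ∀ ℓ → IsLabelClass ℓ (labelClass ℓ)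
  labelClass-isLabelClass ℓ v = mk⇔
    (λ p → let (v∈V1 , ℓ≡) = to T-∧ p in v∈V1 , toWitness ℓ≡)
    (λ (v∈V1 , ℓ≡) → from T-∧ (v∈V1 , fromWitness ℓ≡))

  IsLabelClass-unique : ∀ {ℓ S S′} → IsLabelClass ℓ S → IsLabelClass ℓ S′ → S ≐ S′
  IsLabelClass-unique S≗ S′≗ v =
    T-injective (mk⇔ (from (S′≗ v) ∘ to (S≗ v)) (from (S≗ v) ∘ to (S′≗ v)))

  labelClass⇒sideClique : ∀ {w S} → T (V1 R w) → IsLabelClass (label w) S → IsSideClique R S
  labelClass⇒sideClique {w} {S} w∈V1 S≗ = (λ v → proj₁ ∘ to (S≗ v)) , clique , maximal
    where
    clique : IsClique G S
    clique u v u∈S v∈S u≢v with to (S≗ u) u∈S | to (S≗ v) v∈S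
    ... | u∈V1 , ℓu | v∈V1 , ℓv = from (adjacent⇔sameLabel u∈V1 v∈V1 u≢v) (trans ℓu (≡.sym ℓv))
    maximal : ∀ v → T (V1 R v) → ¬ T (S v) → ¬ (∀ u → T (S u) → T (adj G v u))
    maximal v v∈V1 v∉S v∼S = v∉S (from (S≗ v) (v∈V1 , to (N⁺⇔sameLabel v∈V1 w∈V1) v∼w))
      where
      v∼w : T (N⁺ G v w)
      v∼w = from (T-N⁺ G) (inj₁ (v∼S w (from (S≗ w) (w∈V1 , refl))))

  -- V1 must be inhabited: if V1 = ∅, the empty set is a (vacuously maximal) side clique.
  sideClique⇒labelClass : ∀ {u S} → T (V1 R u) → IsSideClique R S →
                          ∃ λ w → T (V1 R w) × IsLabelClass (label w) S
  sideClique⇒labelClass {u} {S} u∈V1 (S⊆V1 , clique , maximal) with any? (λ v → T? (S v))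
  ... | no S-empty =
    ⊥-elim (maximal u u∈V1 (λ u∈S → S-empty (u , u∈S)) (λ x x∈S → ⊥-elim (S-empty (x , x∈S))))
  ... | yes (w , w∈S) = w , S⊆V1 w w∈S , λ v → mk⇔ (λ v∈S → S⊆V1 v v∈S , sameLabel v∈S) (inS v)
    where
    sameLabel : ∀ {v} → T (S v) → label v ≡ label w
    sameLabel {v} v∈S with v ≟ w
    ... | yes refl = refl
    ... | no v≢w   = adjacent⇒sameLabel (S⊆V1 v v∈S) (S⊆V1 w w∈S) (clique v w v∈S w∈S v≢w)
    inS : ∀ v → T (V1 R v) × label v ≡ label w → T (S v)
    inS v (v∈V1 , ℓ≡) with T? (S v)
    ... | yes v∈S = v∈S
    ... | no v∉S  = ⊥-elim (maximal v v∈V1 v∉S λ x x∈S →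
      from (adjacent⇔sameLabel v∈V1 (S⊆V1 x x∈S) λ { refl → v∉S x∈S }) (trans ℓ≡ (≡.sym (sameLabel x∈S))))

  verticesOfV1 : List (Fin n)
  verticesOfV1 = filter (λ v → T? (V1 R v)) (allFin n)

  sideLabels : List ℕ
  sideLabels = deduplicate _≟ℕ_ (map label verticesOfV1)

  ∈-sideLabels⁺ : ∀ {w} → T (V1 R w) → label w ∈ sideLabels
  ∈-sideLabels⁺ {w} w∈V1 =
    ∈-deduplicate⁺ _≟ℕ_ (∈-map⁺ label (∈-filter⁺ (λ v → T? (V1 R v)) (∈-allFin w) w∈V1))

  ∈-sideLabels⁻ : ∀ {ℓ} → ℓ ∈ sideLabels → ∃ λ w → T (V1 R w) × ℓ ≡ label w
  ∈-sideLabels⁻ ℓ∈ with ∈-map⁻ label (∈-deduplicate⁻ _≟ℕ_ (map label verticesOfV1) ℓ∈)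
  ... | w , w∈ , ℓ≡ = w , proj₂ (∈-filter⁻ (λ v → T? (V1 R v)) {xs = allFin n} w∈) , ℓ≡

  sideLabels-numSides : ∀ {u} → T (V1 R u) → NumSides R (length sideLabels)
  sideLabels-numSides u∈V1 = side , isSide , injective , surjective
    where
    side : Fin (length sideLabels) → VSet n
    side j = labelClass (lookup sideLabels j)
    classOf : ∀ j → ∃ λ w → T (V1 R w) × IsLabelClass (label w) (side j)
    classOf j with ∈-sideLabels⁻ (∈-lookup {xs = sideLabels} j)
    ... | w , w∈V1 , ℓ≡ = w , w∈V1 , subst (λ ℓ → IsLabelClass ℓ (side j)) ℓ≡ (labelClass-isLabelClass _)
    isSide : ∀ j → IsSideClique R (side j)
    isSide j = let (_ , w∈V1 , side≗) = classOf j in labelClass⇒sideClique w∈V1 side≗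
    injective : ∀ j j′ → side j ≐ side j′ → j ≡ j′
    injective j j′ eq with ∈-sideLabels⁻ (∈-lookup {xs = sideLabels} j)
    ... | w , w∈V1 , ℓ≡ = Unique⇒lookup-injective (deduplicate-! (map label verticesOfV1)) j j′
      (trans ℓ≡ (proj₂ (to (labelClass-isLabelClass _ w)
        (subst T (eq w) (from (labelClass-isLabelClass _ w) (w∈V1 , ≡.sym ℓ≡))))))
    surjective : ∀ S → IsSideClique R S → ∃ λ j → S ≐ side j
    surjective S S-side with sideClique⇒labelClass u∈V1 S-side
    ... | w , w∈V1 , S≗ = j , IsLabelClass-unique S≗
      (subst (λ ℓ → IsLabelClass ℓ (side j)) (≡.sym (lookup-index w∈)) (labelClass-isLabelClass _))
      where
      w∈ = ∈-sideLabels⁺ w∈V1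
      j = index w∈

  ⊆sideLabels⇒length≤ : ∀ {k ls} → IsS G k → Unique ls →
                        (∀ {ℓ} → ℓ ∈ ls → ℓ ∈ sideLabels) → length ls ≤ k
  ⊆sideLabels⇒length≤ {ls = []}    _   _   _   = z≤n
  ⊆sideLabels⇒length≤ {ls = _ ∷ _} isS !ls ls⊆ with ∈-sideLabels⁻ (ls⊆ (here refl))
  ... | _ , w∈V1 , _ = ≤-trans (Unique∧⊆⇒length≤ !ls ls⊆) (proj₂ isS R _ (sideLabels-numSides w∈V1))

module Construction {n} {G : Graph n} (R : UnipolarRep G) {I : List (Fin n)}
  (I⊆V1 : ∀ i → i ∈ I → T (V1 R i)) (indep : Independent G I) (!I : Unique I)
  {k : ℕ} (isS : IsS G k) (k∸1≤|I| : k ∸ 1 ≤ length I) where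
  open Labelling R

  label-injectiveOn-I : ∀ {i j} → i ∈ I → j ∈ I → label i ≡ label j → i ≡ j
  label-injectiveOn-I {i} {j} i∈I j∈I ℓ≡ with i ≟ j
  ... | yes i≡j = i≡j
  ... | no i≢j  =
    contradiction (from (adjacent⇔sameLabel (I⊆V1 i i∈I) (I⊆V1 j j∈I) i≢j) ℓ≡) (indep i j i∈I j∈I)

  -- Two further labels together with the |I| labels of I would give |I| + 2 > s(G) side cliques.
  labelsAvoidingI-agree : ∀ {u v} → T (V1 R u) → T (V1 R v) →
                          (∀ {j} → j ∈ I → label u ≢ label j) → (∀ {j} → j ∈ I → label v ≢ label j) →
                          label u ≡ label v
  labelsAvoidingI-agree {u} {v} u∈V1 v∈V1 u∉ v∉ with label u ≟ℕ label v
  ... | yes ℓ≡ = ℓ≡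
  ... | no ℓ≢  = contradiction (≤-trans (∸-monoˡ-≤ 1 |ls|≤k) k∸1≤|I|) (n≮n _)
    where
    ls : List ℕ
    ls = label u ∷ label v ∷ map label I
    !ls : Unique ls
    !ls = (ℓ≢ ∷ All-map⁺ (All.tabulate u∉))
        ∷ All-map⁺ (All.tabulate v∉)
        ∷ Unique-map-injectiveOn label-injectiveOn-I !I
    ls⊆ : ∀ {ℓ} → ℓ ∈ ls → ℓ ∈ sideLabels
    ls⊆ (here refl)         = ∈-sideLabels⁺ u∈V1
    ls⊆ (there (here refl)) = ∈-sideLabels⁺ v∈V1
    ls⊆ (there (there ℓ∈))  with ∈-map⁻ label ℓ∈
    ... | j , j∈I , refl = ∈-sideLabels⁺ (I⊆V1 j j∈I)
    |ls|≤k : suc (suc (length I)) ≤ k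
    |ls|≤k = subst (λ m → suc (suc m) ≤ k) (length-map label I) (⊆sideLabels⇒length≤ isS !ls ls⊆)

  -- `is` lists the vertices of I still to be processed.
  Unclaimed : List (Fin n) → Fin n → Set
  Unclaimed is u = ∀ {j} → j ∈ I → j ∉ is → label u ≢ label j

  Remaining : VSet n → List (Fin n) → Set
  Remaining U is = ∀ u → T (V1 R u) → T (U u) ⇔ Unclaimed is u

  remaining-start : Remaining (λ _ → true) I
  remaining-start _ _ = mk⇔ (λ _ {_} j∈I j∉I → contradiction j∈I j∉I) (λ _ → _)

  remaining-step : ∀ {U i is} → i ∈ I → i ∉ is → Remaining U (i ∷ is) →
                   Remaining (λ v → U v ∧ not (N⁺ G i v)) is
  remaining-step {U} {i} {is} i∈I i∉is rem u u∈V1 = mk⇔ forward backward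
    where
    near⇔ = N⁺⇔sameLabel (I⊆V1 i i∈I) u∈V1
    forward : T (U u ∧ not (N⁺ G i u)) → Unclaimed is u
    forward p {j} j∈I j∉is ℓ≡ with to T-∧ p | j ≟ i
    ... | _ , far   | yes refl = to T-not far (from near⇔ (≡.sym ℓ≡))
    ... | u∈U , _   | no j≢i   = to (rem u u∈V1) u∈U j∈I ([ j≢i , j∉is ] ∘ toSum) ℓ≡
    backward : Unclaimed is u → T (U u ∧ not (N⁺ G i u))
    backward unclaimed = from T-∧
      ( from (rem u u∈V1) (λ j∈I j∉i∷is → unclaimed j∈I (j∉i∷is ∘ there))
      , from T-not (λ near → unclaimed i∈I i∉is (≡.sym (to near⇔ near))))

  IsBlock : VSet n → Set
  IsBlock B = (∀ v → T (B v) → ¬ T (V1 R v)) ⊎ IsSideClique R (λ v → B v ∧ V1 R v)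

  firstBlock-isLabelClass : ∀ {U i is} → i ∈ I → Remaining U (i ∷ is) →
                            IsLabelClass (label i) (λ v → (N⁺ G i v ∧ U v) ∧ V1 R v)
  firstBlock-isLabelClass {U} {i} {is} i∈I rem v = mk⇔ forward backward
    where
    i∈V1 = I⊆V1 i i∈I
    forward : T ((N⁺ G i v ∧ U v) ∧ V1 R v) → T (V1 R v) × label v ≡ label i
    forward p = let (i∼U , v∈V1) = to T-∧ p
                in v∈V1 , ≡.sym (to (N⁺⇔sameLabel i∈V1 v∈V1) (proj₁ (to T-∧ i∼U)))
    backward : T (V1 R v) × label v ≡ label i → T ((N⁺ G i v ∧ U v) ∧ V1 R v)
    backward (v∈V1 , ℓ≡) =
      from T-∧ (from T-∧ (from (N⁺⇔sameLabel i∈V1 v∈V1) (≡.sym ℓ≡) , from (rem v v∈V1) unclaimed) , v∈V1)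
      where
      unclaimed : Unclaimed (i ∷ is) v
      unclaimed j∈I j∉i∷is ℓ≡′ =
        j∉i∷is (here (≡.sym (label-injectiveOn-I i∈I j∈I (trans (≡.sym ℓ≡) ℓ≡′))))

  lastBlock-isBlock : ∀ {U} → Remaining U [] → IsBlock U
  lastBlock-isBlock {U} rem with any? (λ v → T? (U v ∧ V1 R v))
  ... | no none = inj₁ λ v v∈U v∈V1 → none (v , from T-∧ (v∈U , v∈V1))
  ... | yes (w , w∈U∩V1) = inj₂ (labelClass⇒sideClique w∈V1 λ v → mk⇔ forward (backward v))
    where
    w∈U = proj₁ (to T-∧ w∈U∩V1)
    w∈V1 = proj₂ (to T-∧ w∈U∩V1)
    avoidsI : ∀ {x} → T (U x) → T (V1 R x) → ∀ {j} → j ∈ I → label x ≢ label j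
    avoidsI x∈U x∈V1 j∈I = to (rem _ x∈V1) x∈U j∈I λ ()
    forward : ∀ {v} → T (U v ∧ V1 R v) → T (V1 R v) × label v ≡ label w
    forward p = let (v∈U , v∈V1) = to T-∧ p
                in v∈V1 , labelsAvoidingI-agree v∈V1 w∈V1 (avoidsI v∈U v∈V1) (avoidsI w∈U w∈V1)
    backward : ∀ v → T (V1 R v) × label v ≡ label w → T (U v ∧ V1 R v)
    backward v (v∈V1 , ℓ≡) =
      from T-∧ (from (rem v v∈V1) (λ j∈I _ ℓ≡′ → avoidsI w∈U w∈V1 j∈I (trans (≡.sym ℓ≡) ℓ≡′)) , v∈V1)

  blocksFrom-isBlock : ∀ {U is} → Remaining U is → Unique is → (∀ {i} → i ∈ is → i ∈ I) →
                       ∀ {B} → B ∈ blocksFrom G U is → IsBlock B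
  blocksFrom-isBlock {U} {[]} _ _ _ _ with nonempty? U
  blocksFrom-isBlock {U} {[]} rem _ _ (here refl) | true = lastBlock-isBlock rem
  blocksFrom-isBlock {U} {i ∷ is} rem _ is⊆I (here refl) =
    inj₂ (labelClass⇒sideClique (I⊆V1 i i∈I) (firstBlock-isLabelClass i∈I rem))
    where i∈I = is⊆I (here refl)
  blocksFrom-isBlock {U} {i ∷ is} rem (i∉is ∷ !is) is⊆I (there B∈) =
    blocksFrom-isBlock (remaining-step (is⊆I (here refl)) (All¬⇒¬Any i∉is) rem) !is (is⊆I ∘ there) B∈

lemma4p1 : ∀ {n} (G : Graph n) (I : List (Fin n)) → Unique I → Independent G I
    → (Σ ℕ λ k → IsS G k × k ∸ 1 ≤ length I)
    → (Σ (UnipolarRep G) λ R → ∀ i → i ∈ I → T (V1 R i))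
    → Σ (UnipolarRep G) λ R → IsBlockDecomposition R (blocks G I)
lemma4p1 G I !I indep (k , isS , k∸1≤|I|) (R , I⊆V1) =
  R , blocks-isPartition G !I indep , λ _ → blocksFrom-isBlock remaining-start !I id
  where open Construction R I⊆V1 indep !I isS k∸1≤|I|
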